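{- Let $\alpha=(\alpha_1,\dots,\alpha_\ell)$ and $\beta=(\beta_1,\dots,\beta_\ell)$ be compositions of length $\ell$, and put $\hat\alpha_i=\alpha_i-i$, $\hat\beta_j=\beta_j-j$. Suppose that for every $k$ with $1\le k\le\ell$, the number of indices $i\in\{1,\dots,\ell\}$ such that $|\{j:\hat\beta_j>\hat\alpha_i\}|\ge\ell-k+1$ is at most $k-1$. Then the $H$-basis expansion $\mathfrak{S}_{\alpha/\beta}=\sum_{\sigma\in S_\ell}\operatorname{sgn}(\sigma)\,H_{\hat\alpha_1-\hat\beta_{\sigma(1)}}\cdots H_{\hat\alpha_\ell-\hat\beta_{\sigma(\ell)}}$ contains at least one nonzero term before cancellation, i.e. there exists $\sigma\in S_\ell$ with $\hat\alpha_i-\hat\beta_{\sigma(i)}\ge0$ for all $i$.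
   Context: A composition is a finite sequence of positive integers. $\mathrm{NSym}$ is the free associative algebra over $\mathbb{R}$ generated by noncommuting $H_1,H_2,\dots$ with $H_0=1$ and $H_a=0$ for $a<0$. The skew immaculate function $\mathfrak{S}_{\alpha/\beta}$ is the noncommutative determinant (Laplace expansion from the top row sequentially to the bottom) of the matrix $(H_{(\alpha_i-i)-(\beta_j-j)})_{i,j}$; a term is nonzero before cancellation when all its subscripts are nonnegative. -}

module Defs where

open import Data.Nat using (ℕ; suc; _≤_; _<_)
open import Data.Integer as ℤ using (ℤ; +_; _-_)
open import Data.Fin using (Fin; toℕ)
open import Data.List using (length; filter; allFin)
open import Data.Fin.Permutation using (Permutation′; _⟨$⟩ʳ_)
open import Relation.Unary using (Pred; Decidable)
open import Level using (0ℓ)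

-- A composition of length ℓ: entries indexed by Fin ℓ (index i stands for i+1), all positive.
IsComposition : (ℓ : ℕ) → (Fin ℓ → ℕ) → Set
IsComposition ℓ α = ∀ i → 0 < α i

hat : {ℓ : ℕ} → (Fin ℓ → ℕ) → Fin ℓ → ℤ
hat α i = + α i - + suc (toℕ i)

count : (ℓ : ℕ) → {P : Pred (Fin ℓ) 0ℓ} → Decidable P → ℕ
count ℓ P? = length (filter P? (allFin ℓ))

numAbove : {ℓ : ℕ} → (α β : Fin ℓ → ℕ) → Fin ℓ → ℕ
numAbove {ℓ} α β i = count ℓ (λ j → hat α i ℤ.<? hat β j)

-- the term sgn(σ) H_{α̂_1-β̂_σ(1)} ⋯ H_{α̂_ℓ-β̂_σ(ℓ)} is nonzero before cancellation:
-- all subscripts are nonnegative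
TermNonzero : {ℓ : ℕ} → (α β : Fin ℓ → ℕ) → Permutation′ ℓ → Set
TermNonzero α β σ = ∀ i → + 0 ℤ.≤ hat α i - hat β (σ ⟨$⟩ʳ i)

{-# OPTIONS --safe #-}
-- Write a = α̂ and b = β̂. Taking t = ℓ − k, the hypothesis says that for every t < ℓ fewer
-- than ℓ − t rows i have more than t columns j with b j > a i: this is Hall's condition for
-- the bipartite graph joining i to j when b j ≤ a i, and the permutation is built greedily.
-- For t = 0 it yields a row i₀ dominating every b j; match i₀ to a column j₀ where b is
-- maximal. Deleting i₀ and j₀ preserves the condition: a remaining row with some b j above
-- it also lies below b j₀, so if it has more than t entries above it afterwards, it had
-- more than t + 1 before.
module Submission where

open import Defs
open import Level using (0ℓ)
open import Function using (_∘_; id)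
open import Data.Nat using (ℕ; zero; suc; _≤_; _<_; _∸_; _+_; _≤?_; _<?_; z≤n; s≤s)
open import Data.Nat.Properties as ℕ
  using (≤-trans; ≤-reflexive; m≤n+m; <⇒≢; n≮0; m∸n≤m; m∸[m∸n]≡n; +-∸-assoc; +-comm; <⇒≤;
         +-commutativeSemigroup; module ≤-Reasoning)
open import Data.Integer as ℤ using (ℤ)
open import Data.Integer.Properties using (≤-totalOrder; ≮⇒≥; <-≤-trans; i≤j⇒0≤j-i)
open import Data.Fin as Fin using (Fin; punchIn; _≟_)
open import Data.Fin.Properties using (punchIn-punchOut; ¬∀⟶∃¬)
open import Data.Fin.Permutation as Permutation
  using (Permutation; Permutation′; _⟨$⟩ʳ_; insert; insert-punchIn)
open import Data.List using (length; filter; tabulate; allFin)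
open import Data.List.Properties using (length-tabulate; filter-all; filter-none; filter-some)
import Data.List.Relation.Unary.All.Properties as All
import Data.List.Relation.Unary.Any.Properties as Any
open import Data.List.Relation.Binary.Sublist.Propositional using (⊆-refl)
open import Data.List.Relation.Binary.Sublist.Propositional.Properties
  using (filter⁺; length-mono-≤)
open import Data.List.Extrema ≤-totalOrder using (argmax; f[xs]≤f[argmax])
open import Data.Product using (Σ; ∃; _,_)
open import Relation.Nullary using (¬_; Dec; yes; no; contradiction)
open import Relation.Unary using (Pred; Decidable)
open import Relation.Binary.PropositionalEquality
  using (_≡_; refl; sym; trans; cong; subst; subst₂; module ≡-Reasoning)
open import Algebra.Properties.CommutativeSemigroup +-commutativeSemigroup using (x∙yz≈y∙xz)

private
  variable
    m n : ℕ

indicator : {P : Set} → Dec P → ℕ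
indicator (yes _) = 1
indicator (no _)  = 0

indicator-yes : {P : Set} (P? : Dec P) → P → indicator P? ≡ 1
indicator-yes (yes _) _  = refl
indicator-yes (no ¬p) p = contradiction p ¬p

count-tabulate : ∀ n {A : Set} {P : Pred A 0ℓ} (P? : Decidable P) (f : Fin n → A) →
  length (filter P? (tabulate f)) ≡ count n (P? ∘ f)
count-tabulate zero    P? f = refl
count-tabulate (suc n) P? f
  with P? (f Fin.zero)
     | trans (count-tabulate n P? (f ∘ Fin.suc)) (sym (count-tabulate n (P? ∘ f) Fin.suc))
... | yes _ | tails≡ = cong suc tails≡
... | no _  | tails≡ = tails≡

count-suc : ∀ n {P : Pred (Fin (suc n)) 0ℓ} (P? : Decidable P) →
  count (suc n) P? ≡ indicator (P? Fin.zero) + count n (P? ∘ Fin.suc)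
count-suc n P? with P? Fin.zero
... | yes _ = cong suc (count-tabulate n P? Fin.suc)
... | no _  = count-tabulate n P? Fin.suc

count-punchIn : ∀ n {P : Pred (Fin (suc n)) 0ℓ} (P? : Decidable P) (j : Fin (suc n)) →
  count (suc n) P? ≡ indicator (P? j) + count n (P? ∘ punchIn j)
count-punchIn n       P? Fin.zero    = count-suc n P?
count-punchIn (suc n) P? (Fin.suc j) = begin
  count (suc (suc n)) P?
    ≡⟨ count-suc (suc n) P? ⟩
  indicator (P? Fin.zero) + count (suc n) (P? ∘ Fin.suc)
    ≡⟨ cong (indicator (P? Fin.zero) +_) (count-punchIn n (P? ∘ Fin.suc) j) ⟩
  indicator (P? Fin.zero) + (indicator (P? (Fin.suc j)) + count n (P? ∘ Fin.suc ∘ punchIn j))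
    ≡⟨ x∙yz≈y∙xz (indicator (P? Fin.zero)) (indicator (P? (Fin.suc j))) _ ⟩
  indicator (P? (Fin.suc j)) + (indicator (P? Fin.zero) + count n (P? ∘ Fin.suc ∘ punchIn j))
    ≡⟨ cong (indicator (P? (Fin.suc j)) +_) (sym (count-suc n (P? ∘ punchIn (Fin.suc j)))) ⟩
  indicator (P? (Fin.suc j)) + count (suc n) (P? ∘ punchIn (Fin.suc j)) ∎
  where open ≡-Reasoning

module _ {P : Pred (Fin (suc n)) 0ℓ} (P? : Decidable P) where

  count-punchIn-≤ : ∀ j → count n (P? ∘ punchIn j) ≤ count (suc n) P?
  count-punchIn-≤ j = ≤-trans (m≤n+m (count n (P? ∘ punchIn j)) (indicator (P? j)))
                              (≤-reflexive (sym (count-punchIn n P? j)))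

  count-punchIn-< : ∀ {j} → P j → count n (P? ∘ punchIn j) < count (suc n) P?
  count-punchIn-< {j} Pj = ≤-reflexive (sym (begin
    count (suc n) P?
      ≡⟨ count-punchIn n P? j ⟩
    indicator (P? j) + count n (P? ∘ punchIn j)
      ≡⟨ cong (_+ count n (P? ∘ punchIn j)) (indicator-yes (P? j) Pj) ⟩
    suc (count n (P? ∘ punchIn j)) ∎))
    where open ≡-Reasoning

module _ {P : Pred (Fin n) 0ℓ} (P? : Decidable P) where

  count-none : (∀ i → ¬ P i) → count n P? ≡ 0
  count-none ¬P = cong length (filter-none P? (All.tabulate⁺ ¬P))

  count-pos : ∀ {i} → P i → 0 < count n P?
  count-pos {i} Pi = filter-some P? (Any.tabulate⁺ i Pi)

  count<⇒∃¬ : count n P? < n → ∃ λ i → ¬ P i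
  count<⇒∃¬ count<n = ¬∀⟶∃¬ n P P? λ ∀P →
    <⇒≢ count<n (trans (cong length (filter-all P? (All.tabulate⁺ ∀P))) (length-tabulate id))

  count-mono : {Q : Pred (Fin n) 0ℓ} (Q? : Decidable Q) → (∀ {i} → P i → Q i) →
    count n P? ≤ count n Q?
  count-mono Q? P⇒Q = length-mono-≤ (filter⁺ P? Q? (λ { refl → P⇒Q }) (⊆-refl {x = allFin n}))

∀-punchIn : ∀ {p} {P : Pred (Fin (suc n)) p} (i : Fin (suc n)) →
  P i → (∀ k → P (punchIn i k)) → ∀ k → P k
∀-punchIn {P = P} i Pi P∘punchIn k with i ≟ k
... | yes refl = Pi
... | no i≢k   = subst P (punchIn-punchOut i≢k) (P∘punchIn _)

insert-self : ∀ i j (π : Permutation m n) → insert i j π ⟨$⟩ʳ i ≡ j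
insert-self i j π with i ≟ i
... | yes _   = refl
... | no i≢i = contradiction refl i≢i

insert-pointwise : ∀ {r} (R : Fin (suc m) → Fin (suc n) → Set r) i j (π : Permutation m n) →
  R i j → (∀ k → R (punchIn i k) (punchIn j (π ⟨$⟩ʳ k))) →
  ∀ k → R k (insert i j π ⟨$⟩ʳ k)
insert-pointwise R i j π Rij R∘punchIn = ∀-punchIn i
  (subst (R i) (sym (insert-self i j π)) Rij)
  (λ k → subst (R (punchIn i k)) (sym (insert-punchIn i j π k)) (R∘punchIn k))

argmax-index : (b : Fin (suc n) → ℤ) → ∃ λ j₀ → ∀ j → b j ℤ.≤ b j₀
argmax-index {n} b = argmax b Fin.zero (allFin (suc n))
                    , All.tabulate⁻ (f[xs]≤f[argmax] {f = b} Fin.zero (allFin (suc n)))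

above : (a b : Fin n → ℤ) → Fin n → ℕ
above {n} a b i = count n (λ j → a i ℤ.<? b j)

HallCondition : ∀ n → (a b : Fin n → ℤ) → Set
HallCondition n a b = ∀ t → t < n → count n (λ i → t <? above a b i) < n ∸ t

module _ (a b : Fin (suc n) → ℤ) (hall : HallCondition (suc n) a b) where

  dominating-row : ∃ λ i₀ → ∀ j → b j ℤ.≤ a i₀
  dominating-row with count<⇒∃¬ (λ i → 0 <? above a b i) (hall 0 (s≤s z≤n))
  ... | i₀ , ¬0<above = i₀ , λ j → ≮⇒≥ (λ a<b → ¬0<above (count-pos (λ j → a i₀ ℤ.<? b j) a<b))

  HallCondition-remove : ∀ i₀ j₀ → (∀ j → b j ℤ.≤ b j₀) →
    HallCondition n (a ∘ punchIn i₀) (b ∘ punchIn j₀)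
  HallCondition-remove i₀ j₀ b≤bj₀ t t<n = begin-strict
    count n (λ x → t <? above a′ b′ x)
      ≤⟨ count-mono (λ x → t <? above a′ b′ x) (λ x → suc t <? above a b (punchIn i₀ x)) shift ⟩
    count n (λ x → suc t <? above a b (punchIn i₀ x))
      ≤⟨ count-punchIn-≤ (λ i → suc t <? above a b i) i₀ ⟩
    count (suc n) (λ i → suc t <? above a b i)
      <⟨ hall (suc t) (s≤s t<n) ⟩
    n ∸ t ∎
    where
    open ≤-Reasoning
    a′ b′ : Fin n → ℤ
    a′ = a ∘ punchIn i₀
    b′ = b ∘ punchIn j₀
    shift : ∀ {x} → t < above a′ b′ x → suc t < above a b (punchIn i₀ x)
    shift {x} t<above′ with a′ x ℤ.<? b j₀
    ... | yes a′x<bj₀ = ℕ.<-≤-trans (s≤s t<above′) (count-punchIn-< (λ j → a′ x ℤ.<? b j) a′x<bj₀)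
    ... | no a′x≮bj₀  =
      contradiction (subst (t <_) (count-none (λ y → a′ x ℤ.<? b′ y) below) t<above′) n≮0
      where
      below : ∀ y → ¬ (a′ x ℤ.< b′ y)
      below y a′x<b′y = a′x≮bj₀ (<-≤-trans a′x<b′y (b≤bj₀ (punchIn j₀ y)))

HallCondition⇒matching : (a b : Fin n → ℤ) → HallCondition n a b →
  Σ (Permutation′ n) λ σ → ∀ i → b (σ ⟨$⟩ʳ i) ℤ.≤ a i
HallCondition⇒matching {zero}  a b hall = Permutation.id , λ ()
HallCondition⇒matching {suc n} a b hall
  with (i₀ , dominates) ← dominating-row a b hall
     | (j₀ , b≤bj₀) ← argmax-index b
  with (τ , τ-matches) ← HallCondition⇒matching (a ∘ punchIn i₀) (b ∘ punchIn j₀)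
                                                (HallCondition-remove a b hall i₀ j₀ b≤bj₀)
  = insert i₀ j₀ τ , insert-pointwise (λ i j → b j ℤ.≤ a i) i₀ j₀ τ (dominates j₀) τ-matches

hypothesis⇒HallCondition : ∀ ℓ (α β : Fin ℓ → ℕ) →
  ((k : ℕ) → 1 ≤ k → k ≤ ℓ → count ℓ (λ i → (ℓ ∸ k) + 1 ≤? numAbove α β i) ≤ k ∸ 1) →
  HallCondition ℓ (hat α) (hat β)
hypothesis⇒HallCondition ℓ α β hyp t t<ℓ =
  subst₂ (λ s m → count ℓ (λ i → s ≤? numAbove α β i) < m) threshold (sym ℓ∸t≡1+r)
    (s≤s (hyp (suc r) (s≤s z≤n) 1+r≤ℓ))
  where
  r : ℕ
  r = ℓ ∸ suc t
  ℓ∸t≡1+r : ℓ ∸ t ≡ suc r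
  ℓ∸t≡1+r = +-∸-assoc 1 t<ℓ
  1+r≤ℓ : suc r ≤ ℓ
  1+r≤ℓ = subst (_≤ ℓ) ℓ∸t≡1+r (m∸n≤m ℓ t)
  threshold : ℓ ∸ suc r + 1 ≡ suc t
  threshold = begin
    ℓ ∸ suc r + 1       ≡⟨ cong (λ k → ℓ ∸ k + 1) (sym ℓ∸t≡1+r) ⟩
    ℓ ∸ (ℓ ∸ t) + 1     ≡⟨ cong (_+ 1) (m∸[m∸n]≡n (<⇒≤ t<ℓ)) ⟩
    t + 1               ≡⟨ +-comm t 1 ⟩
    suc t               ∎
    where open ≡-Reasoning

theorem5 : (ℓ : ℕ) (α β : Fin ℓ → ℕ) →
    IsComposition ℓ α → IsComposition ℓ β →
    ((k : ℕ) → 1 ≤ k → k ≤ ℓ →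
      count ℓ (λ i → (ℓ ∸ k) + 1 ≤? numAbove α β i) ≤ k ∸ 1) →
    Σ (Permutation′ ℓ) (λ σ → TermNonzero α β σ)
theorem5 ℓ α β _ _ hyp
  with (σ , matched) ← HallCondition⇒matching (hat α) (hat β) (hypothesis⇒HallCondition ℓ α β hyp)
  = σ , λ i → i≤j⇒0≤j-i (matched i)
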